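{- Let $\overrightarrow{H}$ be an absolute oriented clique on $n$ vertices, let $x$ be a vertex of $\overrightarrow{H}$, and let $\overrightarrow{H}'$ be the oriented graph obtained from $\overrightarrow{H}$ by pushing $x$. If $\chi_o(\overrightarrow{H}') = n-1$, then there exists a vertex $x' \neq x$, non-adjacent to $x$, such that $x$ and $x'$ are connected by a directed path of length $2$ in $\overrightarrow{H}$, and $x$ and $x'$ agree on every common neighbor in $\overrightarrow{H}'$.
   Context: An oriented graph is a finite directed graph with no loops, no multiple arcs and no directed cycle of length $2$. A homomorphism of an oriented graph $\overrightarrow{G}$ to an oriented graph $\overrightarrow{T}$ is a map $\phi:V(\overrightarrow{G})\to V(\overrightarrow{T})$ such that for every arc $uv$ of $\overrightarrow{G}$, $\phi(u)\phi(v)$ is an arc of $\overrightarrow{T}$. The oriented chromatic number $\chi_o(\overrightarrow{G})$ is the minimum $|V(\overrightarrow{T})|$ over oriented graphs $\overrightarrow{T}$ admitting a homomorphism from $\overrightarrow{G}$. An absolute oriented clique is an oriented graph $\overrightarrow{C}$ with $\chi_o(\overrightarrow{C}) = |V(\overrightarrow{C})|$. To push a vertex $x$ means to reverse the orientation of every arc incident to $x$, leaving all other arcs unchanged. Two vertices $u,v$ agree on a common neighbor $w$ if $w$ is an in-neighbor of both $u$ and $v$ or an out-neighbor of both $u$ and $v$ (a vertex $w$ is an in-neighbor of $v$ if $wv$ is an arc, and an out-neighbor of $v$ if $vw$ is an arc). -}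

module Defs where

open import Data.Nat using (ℕ; _<_; _∸_)
open import Data.Fin using (Fin; _≟_)
open import Data.Bool using (Bool; true; false; if_then_else_; _∨_)
open import Data.Product using (Σ; _×_; ∃; ∃-syntax)
open import Data.Sum using (_⊎_)
open import Relation.Nullary using (¬_)
open import Relation.Nullary.Decidable using (⌊_⌋)
open import Relation.Binary.PropositionalEquality using (_≡_; _≢_)

record OrientedGraph (n : ℕ) : Set where
  field
    arc         : Fin n → Fin n → Bool
    noLoop      : ∀ u → arc u u ≡ false
    noTwoCycle  : ∀ u v → arc u v ≡ true → arc v u ≡ false
open OrientedGraph public

Arc : ∀ {n} → OrientedGraph n → Fin n → Fin n → Set
Arc G u v = arc G u v ≡ true

Adj : ∀ {n} → OrientedGraph n → Fin n → Fin n → Set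
Adj G u v = Arc G u v ⊎ Arc G v u

IsHom : ∀ {n m} → OrientedGraph n → OrientedGraph m → (Fin n → Fin m) → Set
IsHom G T φ = ∀ u v → Arc G u v → Arc T (φ u) (φ v)

Colorable : ∀ {n} → OrientedGraph n → ℕ → Set
Colorable G k = Σ (OrientedGraph k) λ T → Σ (Fin _ → Fin k) λ φ → IsHom G T φ

ChromaticIs : ∀ {n} → OrientedGraph n → ℕ → Set
ChromaticIs G k = Colorable G k × (∀ j → j < k → ¬ Colorable G j)

AbsoluteClique : ∀ {n} → OrientedGraph n → Set
AbsoluteClique {n} G = ChromaticIs G n

pushArc : ∀ {n} → OrientedGraph n → Fin n → Fin n → Fin n → Bool
pushArc G x u v = if ⌊ u ≟ x ⌋ ∨ ⌊ v ≟ x ⌋ then arc G v u else arc G u v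


private
  push-noLoop : ∀ {n} (G : OrientedGraph n) x u → pushArc G x u u ≡ false
  push-noLoop G x u with ⌊ u ≟ x ⌋
  ... | true  = noLoop G u
  ... | false = noLoop G u

  push-noTwo : ∀ {n} (G : OrientedGraph n) x u v →
               pushArc G x u v ≡ true → pushArc G x v u ≡ false
  push-noTwo G x u v p with ⌊ u ≟ x ⌋ | ⌊ v ≟ x ⌋
  ... | true  | true  = noTwoCycle G v u p
  ... | true  | false = noTwoCycle G v u p
  ... | false | true  = noTwoCycle G v u p
  ... | false | false = noTwoCycle G u v p

push : ∀ {n} → OrientedGraph n → Fin n → OrientedGraph n
push G x = record
  { arc        = pushArc G x
  ; noLoop     = push-noLoop G x
  ; noTwoCycle = push-noTwo G x }

AgreeOn : ∀ {n} → OrientedGraph n → Fin n → Fin n → Fin n → Set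
AgreeOn G u v w = (Arc G w u × Arc G w v) ⊎ (Arc G u w × Arc G v w)

AgreeOnAllCommon : ∀ {n} → OrientedGraph n → Fin n → Fin n → Set
AgreeOnAllCommon G u v = ∀ w → Adj G u w → Adj G v w → AgreeOn G u v w

DiPath2 : ∀ {n} → OrientedGraph n → Fin n → Fin n → Set
DiPath2 G u v = ∃[ w ] ((Arc G u w × Arc G w v) ⊎ (Arc G v w × Arc G w u))

-- Colour the pushed graph H′ with n − 1 colours; by pigeonhole two distinct
-- vertices a, b get the same colour, so they are non-adjacent in H′ and agree
-- on all their common neighbours there, i.e. no directed 2-path joins them in
-- H′. Pushing preserves adjacency, so a, b are non-adjacent in H as well, and
-- since H is an absolute clique they are joined by a directed 2-path in H
-- (otherwise identifying them would colour H with n − 1 colours). Pushing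
-- preserves directed 2-paths between vertices other than x (a path through x
-- is reversed as a whole), so one of a, b must be x; the other one is x′.
module Submission where

open import Defs
open import Data.Nat using (ℕ; zero; suc; _∸_)
open import Data.Nat.Properties using (n<1+n)
open import Data.Fin using (Fin; _≟_; _<_; punchOut)
open import Data.Fin.Properties using (any?; pigeonhole; punchOut-injective; <⇒≢)
open import Data.Bool using (true)
import Data.Bool.Properties as Bool
open import Data.Product using (∃-syntax; _×_; _,_)
open import Data.Sum using (_⊎_; inj₁; inj₂)
open import Function using (_∘_)
open import Relation.Binary.Definitions using (Decidable)
open import Relation.Nullary using (¬_; Dec; yes; no; does; contradiction)
open import Relation.Nullary.Decidable using (_×-dec_; _⊎-dec_; dec-true; dec-false)
open import Relation.Binary.PropositionalEquality
  using (_≡_; _≢_; refl; sym; trans; subst)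

module _ {n} (G : OrientedGraph n) where

  Arc-irrefl : ∀ {a b} → a ≡ b → ¬ Arc G a b
  Arc-irrefl {a} refl p = contradiction (trans (sym p) (noLoop G a)) λ ()

  Arc-asym : ∀ {a b} → Arc G a b → ¬ Arc G b a
  Arc-asym {a} {b} p q = contradiction (trans (sym q) (noTwoCycle G a b p)) λ ()

  Arc? : Decidable (Arc G)
  Arc? a b = arc G a b Bool.≟ true

  DiPath2? : Decidable (DiPath2 G)
  DiPath2? a b = any? λ w → (Arc? a w ×-dec Arc? w b) ⊎-dec (Arc? b w ×-dec Arc? w a)

  DiPath2-sym : ∀ {a b} → DiPath2 G a b → DiPath2 G b a
  DiPath2-sym (w , inj₁ path) = w , inj₂ path
  DiPath2-sym (w , inj₂ path) = w , inj₁ path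

  agree⇒¬DiPath2 : ∀ {a b} → AgreeOnAllCommon G a b → ¬ DiPath2 G a b
  agree⇒¬DiPath2 agree (w , inj₁ (aw , wb)) with agree w (inj₁ aw) (inj₂ wb)
  ... | inj₁ (wa , _) = Arc-asym aw wa
  ... | inj₂ (_ , bw) = Arc-asym wb bw
  agree⇒¬DiPath2 agree (w , inj₂ (bw , wa)) with agree w (inj₂ wa) (inj₁ bw)
  ... | inj₁ (_ , wb) = Arc-asym bw wb
  ... | inj₂ (aw , _) = Arc-asym wa aw

module _ {n k} (G : OrientedGraph n) (T : OrientedGraph k) (φ : Fin n → Fin k)
         (hom : IsHom G T φ) where

  hom-merged⇒¬Adj : ∀ {a b} → φ a ≡ φ b → ¬ Adj G a b
  hom-merged⇒¬Adj {a} {b} φa≡φb (inj₁ ab) = Arc-irrefl T φa≡φb (hom a b ab)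
  hom-merged⇒¬Adj {a} {b} φa≡φb (inj₂ ba) = Arc-irrefl T (sym φa≡φb) (hom b a ba)

  hom-merged⇒agree : ∀ {a b} → φ a ≡ φ b → AgreeOnAllCommon G a b
  hom-merged⇒agree φa≡φb w (inj₁ aw) (inj₁ bw) = inj₂ (aw , bw)
  hom-merged⇒agree φa≡φb w (inj₂ wa) (inj₂ wb) = inj₁ (wa , wb)
  hom-merged⇒agree {a} {b} φa≡φb w (inj₁ aw) (inj₂ wb) =
    contradiction (subst (Arc T (φ w)) (sym φa≡φb) (hom w b wb)) (Arc-asym T (hom a w aw))
  hom-merged⇒agree {a} {b} φa≡φb w (inj₂ wa) (inj₁ bw) =
    contradiction (subst (λ c → Arc T c (φ w)) (sym φa≡φb) (hom b w bw)) (Arc-asym T (hom w a wa))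

module _ {n} (H : OrientedGraph n) (x : Fin n) where

  pushArc-away : ∀ {a b} → a ≢ x → b ≢ x → pushArc H x a b ≡ arc H a b
  pushArc-away {a} {b} a≢x b≢x with a ≟ x | b ≟ x
  ... | yes a≡x | _       = contradiction a≡x a≢x
  ... | no _    | yes b≡x = contradiction b≡x b≢x
  ... | no _    | no _    = refl

  pushArc-from : ∀ b → pushArc H x x b ≡ arc H b x
  pushArc-from b with x ≟ x
  ... | yes _   = refl
  ... | no x≢x  = contradiction refl x≢x

  pushArc-to : ∀ a → pushArc H x a x ≡ arc H x a
  pushArc-to a with a ≟ x | x ≟ x
  ... | yes _ | _      = refl
  ... | no _  | yes _  = refl
  ... | no _  | no x≢x = contradiction refl x≢x

  pushArc-keeps-or-reverses : ∀ a b →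
    (pushArc H x a b ≡ arc H a b × pushArc H x b a ≡ arc H b a) ⊎
    (pushArc H x a b ≡ arc H b a × pushArc H x b a ≡ arc H a b)
  pushArc-keeps-or-reverses a b with a ≟ x | b ≟ x
  ... | yes _ | yes _ = inj₂ (refl , refl)
  ... | yes _ | no _  = inj₂ (refl , refl)
  ... | no _  | yes _ = inj₂ (refl , refl)
  ... | no _  | no _  = inj₁ (refl , refl)

  push-Adj : ∀ {a b} → Adj H a b → Adj (push H x) a b
  push-Adj {a} {b} ab with pushArc-keeps-or-reverses a b | ab
  ... | inj₁ (kept , _) | inj₁ p = inj₁ (trans kept p)
  ... | inj₁ (_ , kept) | inj₂ p = inj₂ (trans kept p)
  ... | inj₂ (_ , rev)  | inj₁ p = inj₂ (trans rev p)
  ... | inj₂ (rev , _)  | inj₂ p = inj₁ (trans rev p)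

  push-path : ∀ {a w b} → a ≢ x → b ≢ x → Arc H a w → Arc H w b → DiPath2 (push H x) a b
  push-path {a} {w} {b} a≢x b≢x aw wb with w ≟ x
  ... | no w≢x = w , inj₁ (trans (pushArc-away a≢x w≢x) aw , trans (pushArc-away w≢x b≢x) wb)
  ... | yes refl = w , inj₂ (trans (pushArc-to b) wb , trans (pushArc-from a) aw)

  push-DiPath2 : ∀ {a b} → a ≢ x → b ≢ x → DiPath2 H a b → DiPath2 (push H x) a b
  push-DiPath2 a≢x b≢x (_ , inj₁ (aw , wb)) = push-path a≢x b≢x aw wb
  push-DiPath2 a≢x b≢x (_ , inj₂ (bw , wa)) = DiPath2-sym (push H x) (push-path b≢x a≢x bw wa)

module _ {k} {R : Fin k → Fin k → Set} (R? : Decidable R)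
         (irrefl : ∀ p → ¬ R p p) (asym : ∀ {p q} → R p q → ¬ R q p) where

  decOrientedGraph : OrientedGraph k
  decOrientedGraph = record
    { arc        = λ p q → does (R? p q)
    ; noLoop     = λ p → dec-false (R? p p) (irrefl p)
    ; noTwoCycle = λ p q pq → dec-false (R? q p) (asym (witness (R? p q) pq))
    }
    where
    witness : ∀ {P} (P? : Dec P) → does P? ≡ true → P
    witness (yes p) _ = p

  decOrientedGraph-arc : ∀ {p q} → R p q → Arc decOrientedGraph p q
  decOrientedGraph-arc {p} {q} = dec-true (R? p q)

module _ {n k} (G : OrientedGraph n) (r : Fin n → Fin k) where

  ImageArc : Fin k → Fin k → Set
  ImageArc p q = ∃[ a ] ∃[ b ] (r a ≡ p × r b ≡ q × Arc G a b)

  image-Colorable :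
    (∀ {a b} → Arc G a b → r a ≢ r b) →
    (∀ {a b c d} → Arc G a b → Arc G c d → r a ≡ r d → r b ≢ r c) →
    Colorable G k
  image-Colorable no-loop no-reverse =
    T , r , λ a b ab → decOrientedGraph-arc ImageArc? irrefl asym (a , b , refl , refl , ab)
    where
    ImageArc? : Decidable ImageArc
    ImageArc? p q = any? λ a → any? λ b → (r a ≟ p) ×-dec ((r b ≟ q) ×-dec Arc? G a b)

    irrefl : ∀ p → ¬ ImageArc p p
    irrefl p (a , b , refl , rb≡ra , ab) = no-loop ab (sym rb≡ra)

    asym : ∀ {p q} → ImageArc p q → ¬ ImageArc q p
    asym (a , b , refl , refl , ab) (c , d , rc≡rb , rd≡ra , cd) = no-reverse ab cd (sym rd≡ra) (sym rc≡rb)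

    T : OrientedGraph k
    T = decOrientedGraph ImageArc? irrefl asym

Ends : ∀ {n} → Fin n → Fin n → Fin n → Fin n → Set
Ends u v a b = (a ≡ u × b ≡ v) ⊎ (a ≡ v × b ≡ u)

Ends-sym : ∀ {n} {u v a b : Fin n} → Ends u v a b → Ends u v b a
Ends-sym (inj₁ (a≡u , b≡v)) = inj₂ (b≡v , a≡u)
Ends-sym (inj₂ (a≡v , b≡u)) = inj₁ (b≡u , a≡v)

module Identify {m} (H : OrientedGraph (suc m)) {u v : Fin (suc m)} (u≢v : u ≢ v) where

  merge : Fin (suc m) → Fin (suc m)
  merge w with w ≟ v
  ... | yes _ = u
  ... | no _  = w

  v≢merge : ∀ w → v ≢ merge w
  v≢merge w with w ≟ v
  ... | yes _   = u≢v ∘ sym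
  ... | no w≢v  = w≢v ∘ sym

  -- identify v with u, then close the gap left by the unused colour v
  contract : Fin (suc m) → Fin m
  contract w = punchOut (v≢merge w)

  merge-cases : ∀ w → (w ≡ v × merge w ≡ u) ⊎ merge w ≡ w
  merge-cases w with w ≟ v
  ... | yes w≡v = inj₁ (w≡v , refl)
  ... | no _    = inj₂ refl

  merge-merged : ∀ {a b} → merge a ≡ merge b → a ≡ b ⊎ Ends u v a b
  merge-merged {a} {b} e with merge-cases a | merge-cases b
  ... | inj₁ (a≡v , _) | inj₁ (b≡v , _) = inj₁ (trans a≡v (sym b≡v))
  ... | inj₁ (a≡v , ma) | inj₂ mb = inj₂ (inj₂ (a≡v , trans (sym mb) (trans (sym e) ma)))
  ... | inj₂ ma | inj₁ (b≡v , mb) = inj₂ (inj₁ (trans (sym ma) (trans e mb) , b≡v))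
  ... | inj₂ ma | inj₂ mb = inj₁ (trans (sym ma) (trans e mb))

  contract-merged : ∀ a b → contract a ≡ contract b → a ≡ b ⊎ Ends u v a b
  contract-merged a b e = merge-merged (punchOut-injective (v≢merge a) (v≢merge b) e)

  module _ (u≁v : ¬ Adj H u v) (no-path : ¬ DiPath2 H u v) where

    ¬Arc-Ends : ∀ {a b} → Ends u v a b → ¬ Arc H a b
    ¬Arc-Ends (inj₁ (refl , refl)) ab = u≁v (inj₁ ab)
    ¬Arc-Ends (inj₂ (refl , refl)) ab = u≁v (inj₂ ab)

    ¬path-Ends : ∀ {a w b} → Ends u v a b → Arc H a w → ¬ Arc H w b
    ¬path-Ends {w = w} (inj₁ (refl , refl)) aw wb = no-path (w , inj₁ (aw , wb))
    ¬path-Ends {w = w} (inj₂ (refl , refl)) aw wb = no-path (w , inj₂ (aw , wb))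

    contract-no-loop : ∀ {a b} → Arc H a b → contract a ≢ contract b
    contract-no-loop {a} {b} ab e with contract-merged a b e
    ... | inj₁ a≡b  = Arc-irrefl H a≡b ab
    ... | inj₂ ends = ¬Arc-Ends ends ab

    contract-no-reverse : ∀ {a b c d} → Arc H a b → Arc H c d →
                          contract a ≡ contract d → contract b ≢ contract c
    contract-no-reverse {a} {b} {c} {d} ab cd e e′ with contract-merged a d e | contract-merged b c e′
    ... | inj₁ refl | inj₁ refl = Arc-asym H ab cd
    ... | inj₁ refl | inj₂ ends = ¬path-Ends (Ends-sym ends) cd ab
    ... | inj₂ ends | inj₁ refl = ¬path-Ends ends ab cd
    ... | inj₂ (inj₁ (refl , _)) | inj₂ (inj₁ (refl , _)) = Arc-irrefl H refl ab
    ... | inj₂ (inj₁ (refl , _)) | inj₂ (inj₂ (refl , _)) = u≁v (inj₁ ab)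
    ... | inj₂ (inj₂ (refl , _)) | inj₂ (inj₁ (refl , _)) = u≁v (inj₂ ab)
    ... | inj₂ (inj₂ (refl , _)) | inj₂ (inj₂ (refl , _)) = Arc-irrefl H refl ab

    identify-Colorable : Colorable H m
    identify-Colorable = image-Colorable H contract contract-no-loop contract-no-reverse

clique-DiPath2 : ∀ {m} (H : OrientedGraph (suc m)) → AbsoluteClique H →
                 ∀ {u v} → u ≢ v → ¬ Adj H u v → DiPath2 H u v
clique-DiPath2 {m} H (_ , minimal) {u} {v} u≢v u≁v with DiPath2? H u v
... | yes path   = path
... | no no-path = contradiction (Identify.identify-Colorable H u≢v u≁v no-path) (minimal m (n<1+n m))

lemma3 : (n : ℕ) (H : OrientedGraph n) (x : Fin n) →
    AbsoluteClique H →
    ChromaticIs (push H x) (n ∸ 1) →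
    ∃[ x′ ] (x′ ≢ x × ¬ Adj H x x′ × DiPath2 H x x′ × AgreeOnAllCommon (push H x) x x′)
lemma3 zero    H () _ _
lemma3 (suc m) H x clique ((T , φ , hom) , _) = from-merged-pair (pigeonhole (n<1+n m) φ)
  where
  Goal : Set
  Goal = ∃[ x′ ] (x′ ≢ x × ¬ Adj H x x′ × DiPath2 H x x′ × AgreeOnAllCommon (push H x) x x′)

  ¬Adj : ∀ {a b} → φ a ≡ φ b → ¬ Adj H a b
  ¬Adj φa≡φb = hom-merged⇒¬Adj (push H x) T φ hom φa≡φb ∘ push-Adj H x

  answer : ∀ {x′} → x′ ≢ x → φ x ≡ φ x′ → Goal
  answer {x′} x′≢x φx≡φx′ = x′ , x′≢x , ¬Adj φx≡φx′
    , clique-DiPath2 H clique (x′≢x ∘ sym) (¬Adj φx≡φx′) , hom-merged⇒agree (push H x) T φ hom φx≡φx′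

  from-merged-pair : ∃[ i ] ∃[ j ] (i < j × φ i ≡ φ j) → Goal
  from-merged-pair (i , j , i<j , φi≡φj) with i ≟ x | j ≟ x
  ... | yes refl | _        = answer (<⇒≢ i<j ∘ sym) φi≡φj
  ... | no _     | yes refl = answer (<⇒≢ i<j) (sym φi≡φj)
  ... | no i≢x   | no j≢x   = contradiction
          (push-DiPath2 H x i≢x j≢x (clique-DiPath2 H clique (<⇒≢ i<j) (¬Adj φi≡φj)))
          (agree⇒¬DiPath2 (push H x) (hom-merged⇒agree (push H x) T φ hom φi≡φj))
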